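{- Consider the map $*:\mathcal D\to\mathcal D$, $(\mu,\nu)\mapsto(\lambda(\mu,\nu),\rho(\mu,\nu))$. Then (i) it is increasing: $(\alpha,\beta)\subseteq(\mu,\nu)$ implies $(\alpha,\beta)^*\subseteq(\mu,\nu)^*$; (ii) it maps standard pairs to standard pairs: if $(0,0)=\pi_0\subseteq\pi_1\subseteq\cdots\subseteq\pi_N=(\mu,\nu)$ is a standard pair, then $(0,0)=\pi_0^*\subseteq\pi_1^*\subseteq\cdots\subseteq\pi_N^*=(\mu,\nu)^*$ is a standard pair; (iii) it maps semistandard pairs to semistandard pairs: if $(0,0)=\pi_0\subseteq\cdots\subseteq\pi_k=(\mu,\nu)$ is a semistandard pair, then $(0,0)=\pi_0^*\subseteq\cdots\subseteq\pi_k^*$ is a semistandard pair.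
   Context: Partitions are weakly decreasing sequences of nonnegative integers, identified up to trailing zeros. For partitions $\mu,\nu$ written as $n$-tuples, the $*$-operation is $(\mu,\nu)^*=(\lambda(\mu,\nu),\rho(\mu,\nu))$ with $\lambda_k=\mu_k-k+\#\{j\in\{1,\dots,n\}: \nu_j-j\ge \mu_k-k\}$ and $\rho_j=\nu_j-j+1+\#\{k\in\{1,\dots,n\}:\mu_k-k>\nu_j-j\}$; $0$ denotes the empty partition. The double Young lattice $\mathcal D$ is the set of pairs of partitions ordered by $(\alpha,\beta)\subseteq(\mu,\nu)$ iff $\alpha\subseteq\mu$ and $\beta\subseteq\nu$ (diagram inclusion), graded by $|\mu|+|\nu|$. A standard pair of shape $(\mu,\nu)$ is a maximal chain in $\mathcal D$ from $(0,0)$ to $(\mu,\nu)$ (each step adds exactly one cell to exactly one of the two partitions). A semistandard pair is a chain $(0,0)=\pi_0\subseteq\pi_1\subseteq\cdots\subseteq\pi_k$ in $\mathcal D$ such that for each step $\pi_j=(\alpha,\beta)\subseteq\pi_{j+1}=(\mu,\nu)$ both $\mu/\alpha$ and $\nu/\beta$ are horizontal strips (no two cells in the same column; possibly empty). -}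

module Defs where

open import Data.Nat as ℕ using (ℕ; zero; suc)
open import Data.Integer using (ℤ; +_; _+_; _-_; _≤_; _<_; _≤?_; _<?_)
open import Data.Fin using (Fin; toℕ) renaming (zero to fzero; suc to fsuc)
open import Data.Bool using (Bool; true; false; if_then_else_)
open import Data.Product using (_×_; _,_; proj₁; proj₂)
open import Relation.Nullary.Decidable using (⌊_⌋)
open import Relation.Nullary using (¬_)

-- A partition written as an n-tuple (μ₁,…,μₙ); index k : Fin n stands for
-- the 1-based position toℕ k + 1.  Entries are integers so that the
-- formulas for the *-operation can be written literally (no truncated
-- subtraction); membership in the lattice D requires nonnegativity.
Tuple : ℕ → Set
Tuple n = Fin n → ℤ

pos : ∀ {n} → Fin n → ℤ
pos k = + suc (toℕ k)

IsPartition : ∀ {n} → Tuple n → Set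
IsPartition {n} μ =
  (∀ (k : Fin n) → + 0 ≤ μ k) × (∀ (i j : Fin n) → toℕ i ℕ.≤ toℕ j → μ j ≤ μ i)

PairT : ℕ → Set
PairT n = Tuple n × Tuple n

InD : ∀ {n} → PairT n → Set
InD (μ , ν) = IsPartition μ × IsPartition ν

_⊆ₚ_ : ∀ {n} → Tuple n → Tuple n → Set
_⊆ₚ_ {n} α μ = ∀ (k : Fin n) → α k ≤ μ k

_⊆D_ : ∀ {n} → PairT n → PairT n → Set
(α , β) ⊆D (μ , ν) = (α ⊆ₚ μ) × (β ⊆ₚ ν)

count : ∀ {n} → (Fin n → Bool) → ℕ
count {zero} f = 0
count {suc n} f = (if f fzero then 1 else 0) ℕ.+ count (λ j → f (fsuc j))

size : ∀ {n} → Tuple n → ℤ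
size {zero} μ = + 0
size {suc n} μ = μ fzero + size (λ j → μ (fsuc j))

sizeD : ∀ {n} → PairT n → ℤ
sizeD (μ , ν) = size μ + size ν

lam : ∀ {n} → PairT n → Tuple n
lam (μ , ν) k = (μ k - pos k) + + count (λ j → ⌊ (μ k - pos k) ≤? (ν j - pos j) ⌋)

rho : ∀ {n} → PairT n → Tuple n
rho (μ , ν) j = ((ν j - pos j) + + 1) + + count (λ k → ⌊ (ν j - pos j) <? (μ k - pos k) ⌋)

star : ∀ {n} → PairT n → PairT n
star p = lam p , rho p

emptyT : ∀ {n} → Tuple n
emptyT _ = + 0

IsZeroPair : ∀ {n} → PairT n → Set
IsZeroPair {n} (μ , ν) = (∀ (k : Fin n) → μ k ≡ + 0) × (∀ (k : Fin n) → ν k ≡ + 0)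
  where open import Relation.Binary.PropositionalEquality using (_≡_)

-- A standard pair: maximal chain π₀ ⊆ ⋯ ⊆ π_N in D from (0,0), i.e. each
-- step is a cover relation of the graded poset D (inclusion, rank +1).
StandardPair : ∀ {n} → ℕ → (ℕ → PairT n) → Set
StandardPair N π =
  IsZeroPair (π 0)
  × (∀ i → i ℕ.≤ N → InD (π i))
  × (∀ i → i ℕ.< N → (π i ⊆D π (suc i)) × (sizeD (π (suc i)) ≡ sizeD (π i) + + 1))
  where open import Relation.Binary.PropositionalEquality using (_≡_)

-- μ/α is a horizontal strip: no two cells of the skew diagram in the same
-- column (cell (i,c) lies in μ/α iff α_i < c ≤ μ_i).
HorizontalStrip : ∀ {n} → Tuple n → Tuple n → Set
HorizontalStrip {n} α μ =
  ∀ (i i' : Fin n) (c : ℤ) → toℕ i ℕ.< toℕ i' →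
    α i < c → c ≤ μ i → α i' < c → c ≤ μ i' → Data.Empty.⊥
  where import Data.Empty

SemistandardPair : ∀ {n} → ℕ → (ℕ → PairT n) → Set
SemistandardPair K π =
  IsZeroPair (π 0)
  × (∀ i → i ℕ.≤ K → InD (π i))
  × (∀ i → i ℕ.< K → (π i ⊆D π (suc i))
       × HorizontalStrip (proj₁ (π i)) (proj₁ (π (suc i)))
       × HorizontalStrip (proj₂ (π i)) (proj₂ (π (suc i))))

-- With the shifted parts b_k = μ_k − k (strictly decreasing when μ is a partition) and
-- lift b t = t + #{j : t ≤ b_j}, one has λ_k = lift (shifted ν) (shifted μ k) and
-- ρ_j = lift (shifted μ) (shifted ν j + 1).  If b' is interlaced below b then
-- lift b' t ≤ lift b (t + 1), since passing from b' to b and from t to t + 1 loses at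
-- most the first index; taking b' = b makes lift monotone in t, and it is plainly
-- monotone in b.  This gives (i), and, as μ/α is a horizontal strip exactly when μ is
-- interlaced below α, it also carries horizontal strips to horizontal strips.  For (ii)
-- it remains that * preserves size: every pair (k, j) is counted exactly once, in λ_k
-- or in ρ_j, so |λ| + |ρ| − |μ| − |ν| depends only on n.

module Submission where

open import Defs
open import Data.Bool using (Bool; true; false; if_then_else_)
open import Data.Empty using (⊥-elim)
open import Data.Fin using (Fin; toℕ; inject₁) renaming (zero to fzero; suc to fsuc)
import Data.Fin.Properties as Finₚ
open import Data.Integer as ℤ using (ℤ; +_; -[1+_]; _+_; _-_; -_; _≤_; _<_; _≤?_; _<?_; +≤+; +<+; -≤-; -<-)
import Data.Integer.Properties as ℤₚ
open import Data.Integer.Tactic.RingSolver using (solve-∀)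
open import Data.Nat as ℕ using (ℕ; zero; suc; z≤n; s≤s)
import Data.Nat.Properties as ℕₚ
open import Data.Product using (_×_; _,_; proj₁; proj₂)
open import Data.Sum using (inj₁; inj₂)
open import Function using (_∘_; _∘₂_)
open import Relation.Binary.PropositionalEquality
open import Level using (0ℓ)
open import Relation.Nullary.Decidable using (Dec; yes; no; ⌊_⌋)
open import Relation.Unary using (Pred; Decidable; _⊆_)
open import Algebra.Properties.CommutativeMonoid.Sum ℤₚ.+-0-commutativeMonoid
  using (sum; ∑-distrib-+; ∑-comm; sum-cong-≗)

indicator : Bool → ℕ
indicator b = if b then 1 else 0

indicator-mono : ∀ {A B : Set} (a? : Dec A) (b? : Dec B) → (A → B) → indicator ⌊ a? ⌋ ℕ.≤ indicator ⌊ b? ⌋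
indicator-mono (no _)  _      _   = z≤n
indicator-mono (yes _) (yes _) _   = ℕₚ.≤-refl
indicator-mono (yes a) (no ¬b) a⇒b = ⊥-elim (¬b (a⇒b a))

indicator≤1 : ∀ b → indicator b ℕ.≤ 1
indicator≤1 false = z≤n
indicator≤1 true  = ℕₚ.≤-refl

count-mono : ∀ {n} {P Q : Pred (Fin n) 0ℓ} (P? : Decidable P) (Q? : Decidable Q) →
  P ⊆ Q → count (⌊_⌋ ∘ P?) ℕ.≤ count (⌊_⌋ ∘ Q?)
count-mono {zero}  _  _  _   = z≤n
count-mono {suc n} P? Q? P⊆Q =
  ℕₚ.+-mono-≤ (indicator-mono (P? fzero) (Q? fzero) P⊆Q) (count-mono (P? ∘ fsuc) (Q? ∘ fsuc) P⊆Q)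

count-cong : ∀ {n} {P Q : Pred (Fin n) 0ℓ} (P? : Decidable P) (Q? : Decidable Q) →
  P ⊆ Q → Q ⊆ P → count (⌊_⌋ ∘ P?) ≡ count (⌊_⌋ ∘ Q?)
count-cong P? Q? P⊆Q Q⊆P = ℕₚ.≤-antisym (count-mono P? Q? P⊆Q) (count-mono Q? P? Q⊆P)

count-inject₁ : ∀ {n} (f : Fin (suc n) → Bool) → count (f ∘ inject₁) ℕ.≤ count f
count-inject₁ {zero}  f = z≤n
count-inject₁ {suc n} f = ℕₚ.+-monoʳ-≤ (indicator (f fzero)) (count-inject₁ (f ∘ fsuc))

count-toℕ< : ∀ {n} m → m ℕ.≤ n → count {n} (λ j → ⌊ toℕ j ℕ.<? m ⌋) ≡ m
count-toℕ< {zero}  zero    _         = refl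
count-toℕ< {suc n} zero    _         = count-toℕ< {n} zero z≤n
count-toℕ< {suc n} (suc m) (s≤s m≤n) = cong suc (trans
  (count-cong {n} (λ j → suc (toℕ j) ℕ.<? suc m) (λ j → toℕ j ℕ.<? m) ℕ.s<s⁻¹ ℕ.s<s)
  (count-toℕ< m m≤n))

+count≡sum : ∀ {n} (f : Fin n → Bool) → + count f ≡ sum (λ j → + indicator (f j))
+count≡sum {zero}  f = refl
+count≡sum {suc n} f = trans (ℤₚ.pos-+ (indicator (f fzero)) _) (cong (_+_ (+ indicator (f fzero))) (+count≡sum (f ∘ fsuc)))

<⇒+1≤ : ∀ {x y} → x < y → x + + 1 ≤ y
<⇒+1≤ {x} x<y = subst (_≤ _) (ℤₚ.+-comm (+ 1) x) (ℤₚ.i<j⇒suc[i]≤j x<y)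

+1≤⇒< : ∀ {x y} → x + + 1 ≤ y → x < y
+1≤⇒< {x} x+1≤y = ℤₚ.suc[i]≤j⇒i<j (subst (_≤ _) (ℤₚ.+-comm x (+ 1)) x+1≤y)

≤-step⇒mono : (f : ℤ → ℤ) → (∀ t → f t ≤ f (t + + 1)) → ∀ {t t'} → t ≤ t' → f t ≤ f t'
≤-step⇒mono f step {t} {t'} t≤t' = subst (λ u → f t ≤ f u) t+[t'-t]≡t' (climb ℤ.∣ t - t' ∣)
  where
  climb : ∀ d → f t ≤ f (t + + d)
  climb zero    = ℤₚ.≤-reflexive (cong f (sym (ℤₚ.+-identityʳ t)))
  climb (suc d) = ℤₚ.≤-trans (climb d) (subst (λ u → f (t + + d) ≤ f u) t+d+1≡ (step (t + + d)))
    where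
    t+d+1≡ : t + + d + + 1 ≡ t + + suc d
    t+d+1≡ = trans (shuffle t (+ d)) (cong (_+_ t) (sym (ℤₚ.pos-+ 1 d)))
      where
      shuffle : ∀ x y → x + y + + 1 ≡ x + (+ 1 + y)
      shuffle = solve-∀
  t+[t'-t]≡t' : t + + ℤ.∣ t - t' ∣ ≡ t'
  t+[t'-t]≡t' = trans (cong (_+_ t) (ℤₚ.∣-∣-≤ t≤t')) (cancel t t')
    where
    cancel : ∀ x y → x + (y - x) ≡ y
    cancel = solve-∀

-- Weakly decreasing is `Interlaced _≤_ μ μ`, strictly decreasing is `Interlaced _<_ b b`,
-- and for partitions α ⊆ μ, `Interlaced _≤_ α μ` says that μ/α is a horizontal strip.
Interlaced : ∀ {n} → (ℤ → ℤ → Set) → Tuple n → Tuple n → Set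
Interlaced {n} R α μ = ∀ (i i' : Fin n) → toℕ i ℕ.< toℕ i' → R (μ i') (α i)

count≥ : ∀ {n} → Tuple n → ℤ → ℕ
count≥ b t = count (λ j → ⌊ t ≤? b j ⌋)

lift : ∀ {n} → Tuple n → ℤ → ℤ
lift b t = t + + count≥ b t

count≥-interlaced : ∀ {n} {b b' : Tuple n} t →
  Interlaced _<_ b b' → count≥ b' t ℕ.≤ suc (count≥ b (t + + 1))
count≥-interlaced {zero}  t _ = z≤n
count≥-interlaced {suc n} {b} {b'} t b'<b = ℕₚ.+-mono-≤ (indicator≤1 _) (begin
  count (λ j → ⌊ t ≤? b' (fsuc j) ⌋)
    ≤⟨ count-mono (λ j → t ≤? b' (fsuc j)) (λ j → t + + 1 ≤? b (inject₁ j)) t≤b'⇒t<b ⟩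
  count (λ j → ⌊ t + + 1 ≤? b (inject₁ j) ⌋)
    ≤⟨ count-inject₁ (λ j → ⌊ t + + 1 ≤? b j ⌋) ⟩
  count≥ b (t + + 1) ∎)
  where
  open ℕₚ.≤-Reasoning
  t≤b'⇒t<b : ∀ {j} → t ≤ b' (fsuc j) → t + + 1 ≤ b (inject₁ j)
  t≤b'⇒t<b {j} t≤b' = <⇒+1≤ (ℤₚ.≤-<-trans t≤b' (b'<b (inject₁ j) (fsuc j) (Finₚ.≤̄⇒inject₁< ℕₚ.≤-refl)))

lift-interlaced : ∀ {n} {b b' : Tuple n} t → Interlaced _<_ b b' → lift b' t ≤ lift b (t + + 1)
lift-interlaced {b = b} {b'} t b'<b = subst (lift b' t ≤_) (sym (ℤₚ.+-assoc t (+ 1) (+ count≥ b (t + + 1))))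
  (ℤₚ.+-monoʳ-≤ t (+≤+ (count≥-interlaced t b'<b)))

lift-monoʳ : ∀ {n} {b : Tuple n} → Interlaced _<_ b b → ∀ {t t'} → t ≤ t' → lift b t ≤ lift b t'
lift-monoʳ {b = b} b-strict = ≤-step⇒mono (lift b) (λ t → lift-interlaced t b-strict)

lift-monoˡ : ∀ {n} {b b' : Tuple n} t → (∀ j → b j ≤ b' j) → lift b t ≤ lift b' t
lift-monoˡ {n} {b} {b'} t b≤b' =
  ℤₚ.+-monoʳ-≤ t (+≤+ (count-mono {n} (λ j → t ≤? b j) (λ j → t ≤? b' j) (λ {j} t≤b → ℤₚ.≤-trans t≤b (b≤b' j))))

lift-interlaced-< : ∀ {n} {b b' : Tuple n} {x z} →
  Interlaced _<_ b b' → Interlaced _<_ b b → x < z → lift b' x ≤ lift b z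
lift-interlaced-< {x = x} b'<b b-strict x<z = ℤₚ.≤-trans (lift-interlaced x b'<b) (lift-monoʳ b-strict (<⇒+1≤ x<z))

shifted : ∀ {n} → Tuple n → Tuple n
shifted μ k = μ k - pos k

shifted-mono : ∀ {n} {α μ : Tuple n} → α ⊆ₚ μ → shifted α ⊆ₚ shifted μ
shifted-mono α⊆μ k = ℤₚ.+-monoˡ-≤ (- pos k) (α⊆μ k)

shifted-interlaced : ∀ {n} {α μ : Tuple n} → Interlaced _≤_ α μ → Interlaced _<_ (shifted α) (shifted μ)
shifted-interlaced α≽μ i i' i<i' = ℤₚ.+-mono-≤-< (α≽μ i i' i<i') (ℤₚ.neg-mono-< (+<+ (s≤s i<i')))

rho≡lift : ∀ {n} (μ ν : Tuple n) j → rho (μ , ν) j ≡ lift (shifted μ) (shifted ν j + + 1)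
rho≡lift {n} μ ν j = cong (λ c → shifted ν j + + 1 + + c)
  (count-cong {n} (λ k → shifted ν j <? shifted μ k) (λ k → shifted ν j + + 1 ≤? shifted μ k) <⇒+1≤ +1≤⇒<)

star-⊆ : ∀ {n} {α β μ ν : Tuple n} → Interlaced _≤_ α α → Interlaced _≤_ β β →
  (α , β) ⊆D (μ , ν) → star (α , β) ⊆D star (μ , ν)
star-⊆ {α = α} {β} {μ} {ν} α-dec β-dec (α⊆μ , β⊆ν) = lam-⊆ , rho-⊆
  where
  open ℤₚ.≤-Reasoning
  lam-⊆ : lam (α , β) ⊆ₚ lam (μ , ν)
  lam-⊆ k = begin
    lift (shifted β) (shifted α k) ≤⟨ lift-monoʳ (shifted-interlaced β-dec) (shifted-mono α⊆μ k) ⟩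
    lift (shifted β) (shifted μ k) ≤⟨ lift-monoˡ (shifted μ k) (shifted-mono β⊆ν) ⟩
    lift (shifted ν) (shifted μ k) ∎
  rho-⊆ : rho (α , β) ⊆ₚ rho (μ , ν)
  rho-⊆ j = begin
    rho (α , β) j                        ≡⟨ rho≡lift α β j ⟩
    lift (shifted α) (shifted β j + + 1) ≤⟨ lift-monoʳ (shifted-interlaced α-dec) (ℤₚ.+-monoˡ-≤ (+ 1) (shifted-mono β⊆ν j)) ⟩
    lift (shifted α) (shifted ν j + + 1) ≤⟨ lift-monoˡ (shifted ν j + + 1) (shifted-mono α⊆μ) ⟩
    lift (shifted μ) (shifted ν j + + 1) ≡⟨ rho≡lift μ ν j ⟨
    rho (μ , ν) j                        ∎

star-interlaced : ∀ {n} {α β μ ν : Tuple n} → Interlaced _≤_ α α → Interlaced _≤_ β β →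
  Interlaced _≤_ α μ → Interlaced _≤_ β ν →
  Interlaced _≤_ (lam (α , β)) (lam (μ , ν)) × Interlaced _≤_ (rho (α , β)) (rho (μ , ν))
star-interlaced {α = α} {β} {μ} {ν} α-dec β-dec α≽μ β≽ν = lam-interlaced , rho-interlaced
  where
  open ℤₚ.≤-Reasoning
  lam-interlaced : Interlaced _≤_ (lam (α , β)) (lam (μ , ν))
  lam-interlaced i i' i<i' =
    lift-interlaced-< (shifted-interlaced β≽ν) (shifted-interlaced β-dec) (shifted-interlaced α≽μ i i' i<i')
  rho-interlaced : Interlaced _≤_ (rho (α , β)) (rho (μ , ν))
  rho-interlaced i i' i<i' = begin
    rho (μ , ν) i'                        ≡⟨ rho≡lift μ ν i' ⟩
    lift (shifted μ) (shifted ν i' + + 1) ≤⟨ lift-interlaced-< (shifted-interlaced α≽μ) (shifted-interlaced α-dec)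
                                               (ℤₚ.+-monoˡ-< (+ 1) (shifted-interlaced β≽ν i i' i<i')) ⟩
    lift (shifted α) (shifted β i + + 1)  ≡⟨ rho≡lift α β i ⟨
    rho (α , β) i                         ∎

partition-interlaced : ∀ {n} {μ : Tuple n} → IsPartition μ → Interlaced _≤_ μ μ
partition-interlaced (_ , antitone) i i' i<i' = antitone i i' (ℕₚ.<⇒≤ i<i')

interlaced⇒antitone : ∀ {n} {μ : Tuple n} → Interlaced _≤_ μ μ → ∀ i j → toℕ i ℕ.≤ toℕ j → μ j ≤ μ i
interlaced⇒antitone {μ = μ} μ-dec i j i≤j with ℕₚ.m≤n⇒m<n∨m≡n i≤j
... | inj₁ i<j = μ-dec i j i<j
... | inj₂ i≡j = ℤₚ.≤-reflexive (cong μ (sym (Finₚ.toℕ-injective i≡j)))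

-- If α i < μ i', column μ i' holds a cell of μ/α in row i and in row i'.
horizontalStrip⇒interlaced : ∀ {n} {α μ : Tuple n} → IsPartition α → IsPartition μ →
  HorizontalStrip α μ → Interlaced _≤_ α μ
horizontalStrip⇒interlaced {α = α} {μ} (_ , α-antitone) (_ , μ-antitone) strip i i' i<i' =
  ℤₚ.≮⇒≥ λ αᵢ<μᵢ' → strip i i' (μ i') i<i' αᵢ<μᵢ' (μ-antitone i i' (ℕₚ.<⇒≤ i<i'))
    (ℤₚ.≤-<-trans (α-antitone i i' (ℕₚ.<⇒≤ i<i')) αᵢ<μᵢ') ℤₚ.≤-refl

interlaced⇒horizontalStrip : ∀ {n} {α μ : Tuple n} → Interlaced _≤_ α μ → HorizontalStrip α μ
interlaced⇒horizontalStrip α≽μ i i' c i<i' αᵢ<c _ _ c≤μᵢ' =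
  ℤₚ.<-irrefl refl (ℤₚ.<-≤-trans αᵢ<c (ℤₚ.≤-trans c≤μᵢ' (α≽μ i i' i<i')))

star-zero : ∀ {n} {μ ν : Tuple n} → IsZeroPair (μ , ν) → IsZeroPair (star (μ , ν))
star-zero {n} {μ} {ν} (μ≡0 , ν≡0) = lam≡0 , rho≡0
  where
  shifted-zero : ∀ {κ : Tuple n} → (∀ k → κ k ≡ + 0) → ∀ k → shifted κ k ≡ -[1+ toℕ k ]
  shifted-zero κ≡0 k = trans (cong (_- pos k) (κ≡0 k)) (ℤₚ.+-identityˡ (- pos k))
  ≤⇔ : ∀ k j → shifted μ k ≤ shifted ν j → toℕ j ℕ.< suc (toℕ k)
  ≤⇔ k j h = s≤s (ℤₚ.drop‿-≤- (subst₂ _≤_ (shifted-zero μ≡0 k) (shifted-zero ν≡0 j) h))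
  ≤⇐ : ∀ k j → toℕ j ℕ.< suc (toℕ k) → shifted μ k ≤ shifted ν j
  ≤⇐ k j (s≤s j≤k) = subst₂ _≤_ (sym (shifted-zero μ≡0 k)) (sym (shifted-zero ν≡0 j)) (-≤- j≤k)
  <⇔ : ∀ j k → shifted ν j < shifted μ k → toℕ k ℕ.< toℕ j
  <⇔ j k h = ℤₚ.drop‿-<- (subst₂ _<_ (shifted-zero ν≡0 j) (shifted-zero μ≡0 k) h)
  <⇐ : ∀ j k → toℕ k ℕ.< toℕ j → shifted ν j < shifted μ k
  <⇐ j k k<j = subst₂ _<_ (sym (shifted-zero ν≡0 j)) (sym (shifted-zero μ≡0 k)) (-<- k<j)
  lam≡0 : ∀ k → lam (μ , ν) k ≡ + 0
  lam≡0 k = begin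
    shifted μ k + + count≥ (shifted ν) (shifted μ k)
      ≡⟨ cong₂ (λ x c → x + + c) (shifted-zero μ≡0 k)
           (trans (count-cong {n} (λ j → shifted μ k ≤? shifted ν j) (λ j → toℕ j ℕ.<? suc (toℕ k)) (≤⇔ k _) (≤⇐ k _))
                  (count-toℕ< (suc (toℕ k)) (Finₚ.toℕ<n k))) ⟩
    -[1+ toℕ k ] + + suc (toℕ k) ≡⟨ ℤₚ.+-inverseˡ (+ suc (toℕ k)) ⟩
    + 0 ∎
    where open ≡-Reasoning
  rho≡0 : ∀ j → rho (μ , ν) j ≡ + 0
  rho≡0 j = begin
    shifted ν j + + 1 + + count (λ k → ⌊ shifted ν j <? shifted μ k ⌋)
      ≡⟨ cong₂ (λ x c → x + + 1 + + c) (shifted-zero ν≡0 j)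
           (trans (count-cong {n} (λ k → shifted ν j <? shifted μ k) (λ k → toℕ k ℕ.<? toℕ j) (<⇔ j _) (<⇐ j _))
                  (count-toℕ< (toℕ j) (ℕₚ.<⇒≤ (Finₚ.toℕ<n j)))) ⟩
    - (+ suc (toℕ j)) + + 1 + + toℕ j ≡⟨ cong (λ x → - x + + 1 + + toℕ j) (ℤₚ.pos-+ 1 (toℕ j)) ⟩
    - (+ 1 + + toℕ j) + + 1 + + toℕ j ≡⟨ cancel (+ toℕ j) ⟩
    + 0 ∎
    where
    open ≡-Reasoning
    cancel : ∀ x → - (+ 1 + x) + + 1 + x ≡ + 0
    cancel = solve-∀

size≡sum : ∀ {n} (μ : Tuple n) → size μ ≡ sum μ
size≡sum {zero}  μ = refl
size≡sum {suc n} μ = cong (_+_ (μ fzero)) (size≡sum (μ ∘ fsuc))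

size-zero : ∀ {n} {μ : Tuple n} → (∀ k → μ k ≡ + 0) → size μ ≡ + 0
size-zero {zero}  _   = refl
size-zero {suc n} μ≡0 = cong₂ _+_ (μ≡0 fzero) (size-zero (μ≡0 ∘ fsuc))

indicator-≤+indicator-> : ∀ x y → + indicator ⌊ x ≤? y ⌋ + + indicator ⌊ y <? x ⌋ ≡ + 1
indicator-≤+indicator-> x y with x ≤? y | y <? x
... | yes _   | no _    = refl
... | no _    | yes _   = refl
... | yes x≤y | yes y<x = ⊥-elim (ℤₚ.≤⇒≯ x≤y y<x)
... | no x≰y  | no y≮x  = ⊥-elim (y≮x (ℤₚ.≰⇒> x≰y))

∑count≤+∑count>≡∑∑1 : ∀ {n} (a b : Tuple n) →
  sum (λ k → + count (λ j → ⌊ a k ≤? b j ⌋)) + sum (λ j → + count (λ k → ⌊ b j <? a k ⌋))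
    ≡ sum (λ (k : Fin n) → sum (λ (j : Fin n) → + 1))
∑count≤+∑count>≡∑∑1 {n} a b = begin
  sum (λ k → + count (λ j → ⌊ a k ≤? b j ⌋)) + sum (λ j → + count (λ k → ⌊ b j <? a k ⌋))
    ≡⟨ cong₂ _+_ (sum-cong-≗ {n} (λ k → +count≡sum {n} _)) (sum-cong-≗ {n} (λ j → +count≡sum {n} _)) ⟩
  sum (λ k → sum (λ j → χ≤ k j)) + sum (λ j → sum (λ k → χ> k j))
    ≡⟨ cong (_+_ (sum (λ k → sum (λ j → χ≤ k j)))) (∑-comm {n} {n} (λ j k → χ> k j)) ⟩
  sum (λ k → sum (λ j → χ≤ k j)) + sum (λ k → sum (λ j → χ> k j))
    ≡⟨ ∑-distrib-+ {n} (λ k → sum (λ j → χ≤ k j)) (λ k → sum (λ j → χ> k j)) ⟨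
  sum (λ k → sum (λ j → χ≤ k j) + sum (λ j → χ> k j))
    ≡⟨ sum-cong-≗ {n} (λ k → ∑-distrib-+ {n} (χ≤ k) (λ j → χ> k j)) ⟨
  sum (λ k → sum (λ j → χ≤ k j + χ> k j))
    ≡⟨ sum-cong-≗ {n} (λ k → sum-cong-≗ {n} (λ j → indicator-≤+indicator-> (a k) (b j))) ⟩
  sum (λ (k : Fin n) → sum (λ (j : Fin n) → + 1)) ∎
  where
  open ≡-Reasoning
  χ≤ χ> : Fin n → Fin n → ℤ
  χ≤ k j = + indicator ⌊ a k ≤? b j ⌋
  χ> k j = + indicator ⌊ b j <? a k ⌋

starDefect : ℕ → ℤ
starDefect n = sum (λ (k : Fin n) → - pos k) + sum (λ (k : Fin n) → - pos k) + sum (λ (_ : Fin n) → + 1)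
  + sum (λ (k : Fin n) → sum (λ (j : Fin n) → + 1))

sizeD-star : ∀ {n} (μ ν : Tuple n) → sizeD (star (μ , ν)) ≡ sizeD (μ , ν) + starDefect n
sizeD-star {n} μ ν = begin
  size (lam (μ , ν)) + size (rho (μ , ν))
    ≡⟨ cong₂ _+_ (size≡sum (lam (μ , ν))) (size≡sum (rho (μ , ν))) ⟩
  sum (lam (μ , ν)) + sum (rho (μ , ν))
    ≡⟨ cong₂ _+_ (trans (∑-distrib-+ {n} (shifted μ) _) (cong (_+ A) (∑-distrib-+ {n} μ _)))
                 (trans (∑-distrib-+ {n} _ _) (cong (_+ B) (trans (∑-distrib-+ {n} (shifted ν) _) (cong (_+ O) (∑-distrib-+ {n} ν _))))) ⟩
  (sum μ + P + A) + (sum ν + P + O + B)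
    ≡⟨ regroup (sum μ) (sum ν) P O A B ⟩
  (sum μ + sum ν) + (P + P + O + (A + B))
    ≡⟨ cong₂ (λ s x → s + (P + P + O + x)) (sym (cong₂ _+_ (size≡sum μ) (size≡sum ν))) (∑count≤+∑count>≡∑∑1 (shifted μ) (shifted ν)) ⟩
  sizeD (μ , ν) + starDefect n ∎
  where
  open ≡-Reasoning
  P O A B : ℤ
  P = sum (λ (k : Fin n) → - pos k)
  O = sum (λ (_ : Fin n) → + 1)
  A = sum (λ k → + count≥ (shifted ν) (shifted μ k))
  B = sum (λ j → + count (λ k → ⌊ shifted ν j <? shifted μ k ⌋))
  regroup : ∀ m v p o a b → (m + p + a) + (v + p + o + b) ≡ (m + v) + (p + p + o + (a + b))
  regroup = solve-∀

-- Read off at the empty pair, which * fixes and which has size 0.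
starDefect≡0 : ∀ n → starDefect n ≡ + 0
starDefect≡0 n = begin
  starDefect n                                    ≡⟨ ℤₚ.+-identityˡ (starDefect n) ⟨
  + 0 + starDefect n                              ≡⟨ cong (_+ starDefect n) (sym (cong₂ _+_ (size-zero {n} (λ _ → refl)) (size-zero {n} (λ _ → refl)))) ⟩
  sizeD (emptyT {n} , emptyT) + starDefect n      ≡⟨ sizeD-star {n} emptyT emptyT ⟨
  sizeD (star (emptyT {n} , emptyT))              ≡⟨ cong₂ _+_ (size-zero (proj₁ empty*)) (size-zero (proj₂ empty*)) ⟩
  + 0                                             ∎
  where
  open ≡-Reasoning
  empty* : IsZeroPair (star (emptyT {n} , emptyT))
  empty* = star-zero ((λ _ → refl) , (λ _ → refl))

sizeD-star-invariant : ∀ {n} (p : PairT n) → sizeD (star p) ≡ sizeD p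
sizeD-star-invariant {n} (μ , ν) = trans (sizeD-star μ ν) (trans (cong (_+_ (sizeD (μ , ν))) (starDefect≡0 n)) (ℤₚ.+-identityʳ _))

star-mono : ∀ {n} {a b : PairT n} → InD a → a ⊆D b → star a ⊆D star b
star-mono (α-part , β-part) = star-⊆ (partition-interlaced α-part) (partition-interlaced β-part)

-- Nonnegativity comes from monotonicity, comparing with the empty pair.
star-InD : ∀ {n} {p : PairT n} → InD p → InD (star p)
star-InD {n} {μ , ν} (μ-part@(μ≥0 , _) , ν-part@(ν≥0 , _)) =
  (lam≥0 , interlaced⇒antitone (proj₁ star-dec)) , (rho≥0 , interlaced⇒antitone (proj₂ star-dec))
  where
  μ-dec = partition-interlaced μ-part
  ν-dec = partition-interlaced ν-part
  star-dec = star-interlaced μ-dec ν-dec μ-dec ν-dec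
  empty-dec : Interlaced _≤_ (emptyT {n}) emptyT
  empty-dec _ _ _ = ℤₚ.≤-refl
  empty* : IsZeroPair (star (emptyT {n} , emptyT))
  empty* = star-zero ((λ _ → refl) , (λ _ → refl))
  star-empty⊆ : star (emptyT , emptyT) ⊆D star (μ , ν)
  star-empty⊆ = star-⊆ empty-dec empty-dec (μ≥0 , ν≥0)
  lam≥0 : ∀ k → + 0 ≤ lam (μ , ν) k
  lam≥0 k = subst (_≤ lam (μ , ν) k) (proj₁ empty* k) (proj₁ star-empty⊆ k)
  rho≥0 : ∀ j → + 0 ≤ rho (μ , ν) j
  rho≥0 j = subst (_≤ rho (μ , ν) j) (proj₂ empty* j) (proj₂ star-empty⊆ j)

star-cover : ∀ {n} {a b : PairT n} → InD a → a ⊆D b → sizeD b ≡ sizeD a + + 1 →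
  (star a ⊆D star b) × (sizeD (star b) ≡ sizeD (star a) + + 1)
star-cover {a = a} {b} a-InD a⊆b |b|≡|a|+1 = star-mono a-InD a⊆b , (begin
  sizeD (star b)   ≡⟨ sizeD-star-invariant b ⟩
  sizeD b          ≡⟨ |b|≡|a|+1 ⟩
  sizeD a + + 1    ≡⟨ cong (_+ + 1) (sizeD-star-invariant a) ⟨
  sizeD (star a) + + 1 ∎)
  where open ≡-Reasoning

star-horizontalStrips : ∀ {n} {α β μ ν : Tuple n} → InD (α , β) → InD (μ , ν) →
  HorizontalStrip α μ → HorizontalStrip β ν →
  HorizontalStrip (lam (α , β)) (lam (μ , ν)) × HorizontalStrip (rho (α , β)) (rho (μ , ν))
star-horizontalStrips (α-part , β-part) (μ-part , ν-part) α-strip β-strip =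
  interlaced⇒horizontalStrip (proj₁ star-strip) , interlaced⇒horizontalStrip (proj₂ star-strip)
  where
  star-strip = star-interlaced (partition-interlaced α-part) (partition-interlaced β-part)
    (horizontalStrip⇒interlaced α-part μ-part α-strip) (horizontalStrip⇒interlaced β-part ν-part β-strip)

lemma5p1 : (n : ℕ) →
    ((a b : PairT n) → InD a → InD b → a ⊆D b → star a ⊆D star b)
    × ((N : ℕ) (π : ℕ → PairT n) → StandardPair N π → StandardPair N (star ∘ π))
    × ((K : ℕ) (π : ℕ → PairT n) → SemistandardPair K π → SemistandardPair K (star ∘ π))
lemma5p1 n = (λ _ _ a-InD _ → star-mono a-InD) , standard , semistandard
  where
  standard : (N : ℕ) (π : ℕ → PairT n) → StandardPair N π → StandardPair N (star ∘ π)
  standard N π (π₀≡0 , π-InD , π-step) =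
    star-zero π₀≡0 , star-InD ∘₂ π-InD ,
    λ i i<N → star-cover (π-InD i (ℕₚ.<⇒≤ i<N)) (proj₁ (π-step i i<N)) (proj₂ (π-step i i<N))
  semistandard : (K : ℕ) (π : ℕ → PairT n) → SemistandardPair K π → SemistandardPair K (star ∘ π)
  semistandard K π (π₀≡0 , π-InD , π-step) =
    star-zero π₀≡0 , star-InD ∘₂ π-InD ,
    λ i i<K → let πᵢ-InD = π-InD i (ℕₚ.<⇒≤ i<K); (πᵢ⊆πᵢ₊₁ , μ-strip , ν-strip) = π-step i i<K in
      star-mono πᵢ-InD πᵢ⊆πᵢ₊₁ , star-horizontalStrips πᵢ-InD (π-InD (suc i) i<K) μ-strip ν-strip
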